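{- For every $d,n\in\mathbb{N}$, \[ \sum_{k=1}^{\lfloor (n+1)/2\rfloor}\binom n{2k-1}\frac{1}{(2k-1)^d}=\frac{\zeta_n^\star(\{1\}_d;2)}{2}. \]
   Context: $\{1\}_d$ denotes the argument $1$ repeated $d$ times. For $n\in\mathbb{N}$, positive integers $s_1,\dots,s_d$ and $a\in\mathbb{R}$, $\zeta_n^\star(s_1,\dots,s_d;a):=\sum_{n\ge n_1\ge\cdots\ge n_d\ge 1}\frac{a^{n_d}}{n_1^{s_1}\cdots n_d^{s_d}}$, so $\zeta_n^\star(\{1\}_d;2)=\sum_{n\ge n_1\ge\cdots\ge n_d\ge1}\frac{2^{n_d}}{n_1\cdots n_d}$. -}

module Defs where

open import Data.Nat as ℕ using (ℕ; zero; suc)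
open import Data.Integer using (+_)
open import Data.Rational using (ℚ; 0ℚ; 1ℚ; _+_; _*_; _/_)
open import Data.List using (List; []; _∷_)

sumFrom1 : ℕ → (ℕ → ℚ) → ℚ
sumFrom1 zero    f = 0ℚ
sumFrom1 (suc n) f = sumFrom1 n f + f (suc n)

powℚ : ℚ → ℕ → ℚ
powℚ a zero    = 1ℚ
powℚ a (suc m) = a * powℚ a m

-- 1 / m^s as a rational (only ever used with m ≥ 1)
invPow : ℕ → ℕ → ℚ
invPow m s with m ℕ.^ s
... | zero  = 0ℚ
... | suc k = + 1 / suc k

-- ζ⋆_n(s₁,…,s_d; a) = ∑_{n ≥ n₁ ≥ ⋯ ≥ n_d ≥ 1} a^{n_d} / (n₁^{s₁} ⋯ n_d^{s_d}),
-- defined by recursion on the list of exponents (s₁,…,s_d):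
--   ζ⋆ n (s ∷ ss) a = ∑_{m=1}^{n} (1/m^s) · ζ⋆ m ss a,  and the base case
--   ζ⋆ m [] a = a^m  supplies the weight a^{n_d} of the last index.
-- (The theorem only uses d ≥ 1.)
zetaStar : ℕ → List ℕ → ℚ → ℚ
zetaStar m []       a = powℚ a m
zetaStar n (s ∷ ss) a = sumFrom1 n (λ m → invPow m s * zetaStar m ss a)

-- Write Z(d, n) = ζ⋆_n({1}_d; 2). Both sides satisfy the same recursion in (d, n): on the zeta
-- side Z(d+1, n+1) = Z(d+1, n) + Z(d, n+1) / (n+1) is the definition; on the binomial side it comes
-- from Pascal's rule C(n+1, m+1) = C(n, m+1) + C(n, m) and the absorption identity
-- (m+1) C(n+1, m+1) = (n+1) C(n, m), which trades one factor 1/(m+1) for 1/(n+1).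
-- The recursion bottoms out at d = 0 only with n+1 ≥ 1, where the binomial side is the sum of the
-- odd binomial coefficients of n+1, i.e. 2^n = Z(0, n+1) / 2 (at d = n = 0 the identity fails).
-- The sum may run up to any N with n ≤ 2N, the further terms being zero; this range survives
-- the step from n+1 to n, so the induction never has to change it.
module Submission where

open import Defs
open import Data.Nat using (ℕ; _≥_) renaming (_+_ to _+ℕ_; _*_ to _*ℕ_; _∸_ to _∸ℕ_; _/_ to _/ℕ_)
open import Data.Nat.Combinatorics using (_C_)
open import Data.Integer using (+_)
open import Data.Rational using (ℚ; _*_; _/_)
open import Data.List using (replicate)
open import Relation.Binary.PropositionalEquality using (_≡_)

open import Data.Nat using (zero; suc; pred; _^_; _≤_; _<_; s≤s; z≤n)
import Data.Nat.Properties as ℕ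
import Data.Nat.DivMod as ℕ
open import Data.Nat.Combinatorics using (nCk+nC[k+1]≡[n+1]C[k+1]; nC1≡n)
import Data.Integer as ℤ
import Data.Integer.Properties as ℤ
open import Data.Rational using (0ℚ; 1ℚ; _+_; fromℚᵘ)
open import Data.Rational.Properties
  using (toℚᵘ-injective; toℚᵘ-fromℚᵘ; fromℚᵘ-cong; toℚᵘ-homo-+; toℚᵘ-homo-*;
         +-identityʳ; *-identityʳ; *-zeroˡ; *-distribʳ-+)
open import Data.Rational.Solver using (module +-*-Solver)
import Data.Rational.Unnormalised as ℚᵘ
import Data.Rational.Unnormalised.Properties as ℚᵘ
open import Relation.Binary.PropositionalEquality using (refl; sym; trans; cong; cong₂; subst; module ≡-Reasoning)

[k+1]*[n+1]C[k+1]≡[n+1]*nCk : ∀ n k → suc k *ℕ (suc n C suc k) ≡ suc n *ℕ (n C k)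
[k+1]*[n+1]C[k+1]≡[n+1]*nCk zero    zero    = refl
[k+1]*[n+1]C[k+1]≡[n+1]*nCk zero    (suc k) = ℕ.*-zeroʳ (suc (suc k))
[k+1]*[n+1]C[k+1]≡[n+1]*nCk (suc n) zero    =
  trans (ℕ.*-identityˡ _) (trans (nC1≡n (suc (suc n))) (sym (ℕ.*-identityʳ (suc (suc n)))))
[k+1]*[n+1]C[k+1]≡[n+1]*nCk (suc n) (suc k) = begin
  suc (suc k) *ℕ (suc (suc n) C suc (suc k))      ≡⟨ cong (suc (suc k) *ℕ_) (sym (nCk+nC[k+1]≡[n+1]C[k+1] (suc n) (suc k))) ⟩
  suc (suc k) *ℕ (x +ℕ y)                         ≡⟨ ℕ.*-distribˡ-+ (suc (suc k)) x y ⟩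
  suc (suc k) *ℕ x +ℕ suc (suc k) *ℕ y            ≡⟨ ℕ.+-assoc x (suc k *ℕ x) _ ⟩
  x +ℕ (suc k *ℕ x +ℕ suc (suc k) *ℕ y)           ≡⟨ cong (x +ℕ_) (cong₂ _+ℕ_ ([k+1]*[n+1]C[k+1]≡[n+1]*nCk n k)
                                                                             ([k+1]*[n+1]C[k+1]≡[n+1]*nCk n (suc k))) ⟩
  x +ℕ (suc n *ℕ (n C k) +ℕ suc n *ℕ (n C suc k))  ≡⟨ cong (x +ℕ_) (sym (ℕ.*-distribˡ-+ (suc n) (n C k) (n C suc k))) ⟩
  x +ℕ suc n *ℕ (n C k +ℕ n C suc k)               ≡⟨ cong (λ z → x +ℕ suc n *ℕ z) (nCk+nC[k+1]≡[n+1]C[k+1] n k) ⟩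
  suc (suc n) *ℕ x                                ∎
  where
  open ≡-Reasoning
  x = suc n C suc k
  y = suc n C suc (suc k)

n≤2*[[n+1]/2] : ∀ n → n ≤ 2 *ℕ ((n +ℕ 1) /ℕ 2)
n≤2*[[n+1]/2] n = ℕ.≤-pred (begin
  suc n                    ≡⟨ ℕ.+-comm 1 n ⟩
  n +ℕ 1                   ≡⟨ ℕ.m≡m%n+[m/n]*n (n +ℕ 1) 2 ⟩
  (n +ℕ 1) ℕ.% 2 +ℕ q *ℕ 2 ≤⟨ ℕ.+-monoˡ-≤ (q *ℕ 2) (ℕ.≤-pred (ℕ.m%n<n (n +ℕ 1) 2)) ⟩
  suc (q *ℕ 2)             ≡⟨ cong suc (ℕ.*-comm q 2) ⟩
  suc (2 *ℕ q)             ∎)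
  where
  open ℕ.≤-Reasoning
  q = (n +ℕ 1) /ℕ 2

fromℚᵘ-homo-+ : ∀ p q → fromℚᵘ (p ℚᵘ.+ q) ≡ fromℚᵘ p + fromℚᵘ q
fromℚᵘ-homo-+ p q = toℚᵘ-injective (ℚᵘ.≃-trans (toℚᵘ-fromℚᵘ (p ℚᵘ.+ q)) (ℚᵘ.≃-sym (ℚᵘ.≃-trans
  (toℚᵘ-homo-+ (fromℚᵘ p) (fromℚᵘ q)) (ℚᵘ.+-cong (toℚᵘ-fromℚᵘ p) (toℚᵘ-fromℚᵘ q)))))

fromℚᵘ-homo-* : ∀ p q → fromℚᵘ (p ℚᵘ.* q) ≡ fromℚᵘ p * fromℚᵘ q
fromℚᵘ-homo-* p q = toℚᵘ-injective (ℚᵘ.≃-trans (toℚᵘ-fromℚᵘ (p ℚᵘ.* q)) (ℚᵘ.≃-sym (ℚᵘ.≃-trans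
  (toℚᵘ-homo-* (fromℚᵘ p) (fromℚᵘ q)) (ℚᵘ.*-cong (toℚᵘ-fromℚᵘ p) (toℚᵘ-fromℚᵘ q)))))

fromℕ : ℕ → ℚ
fromℕ a = + a / 1

½ : ℚ
½ = + 1 / 2

fromℕ-homo-+ : ∀ a b → fromℕ (a +ℕ b) ≡ fromℕ a + fromℕ b
fromℕ-homo-+ a b = trans (cong (_/ 1) numerator) (fromℚᵘ-homo-+ (+ a ℚᵘ./ 1) (+ b ℚᵘ./ 1))
  where
  numerator : + (a +ℕ b) ≡ + a ℤ.* + 1 ℤ.+ + b ℤ.* + 1
  numerator = trans (ℤ.pos-+ a b) (sym (cong₂ ℤ._+_ (ℤ.*-identityʳ (+ a)) (ℤ.*-identityʳ (+ b))))

fromℕ-homo-* : ∀ a b → fromℕ (a *ℕ b) ≡ fromℕ a * fromℕ b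
fromℕ-homo-* a b = trans (cong (_/ 1) (ℤ.pos-* a b)) (fromℚᵘ-homo-* (+ a ℚᵘ./ 1) (+ b ℚᵘ./ 1))

fromℕ-*-cancel-/ : ∀ a b → fromℕ (suc a) * (+ 1 / (suc a *ℕ suc b)) ≡ + 1 / suc b
fromℕ-*-cancel-/ a b = begin
  fromℕ (suc a) * (+ 1 / (suc a *ℕ suc b))
    ≡⟨ sym (fromℚᵘ-homo-* (+ suc a ℚᵘ./ 1) (+ 1 ℚᵘ./ (suc a *ℕ suc b))) ⟩
  fromℚᵘ ((+ suc a ℤ.* + 1) ℚᵘ./ (1 *ℕ (suc a *ℕ suc b)))
    ≡⟨ cong fromℚᵘ (ℚᵘ./-cong {+ suc a ℤ.* + 1} {1 *ℕ (suc a *ℕ suc b)} {+ suc a ℤ.* + 1} {suc a *ℕ suc b} refl (ℕ.*-identityˡ (suc a *ℕ suc b))) ⟩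
  fromℚᵘ ((+ suc a ℤ.* + 1) ℚᵘ./ (suc a *ℕ suc b))
    ≡⟨ fromℚᵘ-cong (ℚᵘ.*-cancelˡ-/ (suc a) {+ 1} {suc b}) ⟩
  + 1 / suc b
    ∎
  where open ≡-Reasoning

invPow≡1/ : ∀ m s {k} → m ^ s ≡ suc k → invPow m s ≡ + 1 / suc k
invPow≡1/ m s eq with m ^ s
invPow≡1/ m s refl | _ = refl

fromℕ-*-invPow-suc : ∀ m e → fromℕ (suc m) * invPow (suc m) (suc e) ≡ invPow (suc m) e
fromℕ-*-invPow-suc m e = begin
  fromℕ (suc m) * invPow (suc m) (suc e)    ≡⟨ cong (fromℕ (suc m) *_) (invPow≡1/ (suc m) (suc e) (cong (suc m *ℕ_) m^e≡1+k)) ⟩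
  fromℕ (suc m) * (+ 1 / (suc m *ℕ suc k))  ≡⟨ fromℕ-*-cancel-/ m k ⟩
  + 1 / suc k                               ≡⟨ sym (invPow≡1/ (suc m) e m^e≡1+k) ⟩
  invPow (suc m) e                          ∎
  where
  open ≡-Reasoning
  k = pred (suc m ^ e)
  m^e≡1+k : suc m ^ e ≡ suc k
  m^e≡1+k = sym (ℕ.suc-pred (suc m ^ e) {{ℕ.m^n≢0 (suc m) e}})

sumFrom1-cong : ∀ N {f g : ℕ → ℚ} → (∀ i → f (suc i) ≡ g (suc i)) → sumFrom1 N f ≡ sumFrom1 N g
sumFrom1-cong zero    f≗g = refl
sumFrom1-cong (suc N) f≗g = cong₂ _+_ (sumFrom1-cong N f≗g) (f≗g N)

sumFrom1-0 : ∀ N → sumFrom1 N (λ _ → 0ℚ) ≡ 0ℚ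
sumFrom1-0 zero    = refl
sumFrom1-0 (suc N) = trans (+-identityʳ _) (sumFrom1-0 N)

sumFrom1-+ : ∀ N (f g : ℕ → ℚ) → sumFrom1 N (λ k → f k + g k) ≡ sumFrom1 N f + sumFrom1 N g
sumFrom1-+ zero    f g = refl
sumFrom1-+ (suc N) f g = trans (cong (_+ (f (suc N) + g (suc N))) (sumFrom1-+ N f g))
  (solve 4 (λ a b c d → (a :+ b) :+ (c :+ d) := (a :+ c) :+ (b :+ d)) refl
    (sumFrom1 N f) (sumFrom1 N g) (f (suc N)) (g (suc N)))
  where open +-*-Solver

sumFrom1-*ʳ : ∀ N (f : ℕ → ℚ) c → sumFrom1 N (λ k → f k * c) ≡ sumFrom1 N f * c
sumFrom1-*ʳ zero    f c = sym (*-zeroˡ c)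
sumFrom1-*ʳ (suc N) f c =
  trans (cong (_+ f (suc N) * c) (sumFrom1-*ʳ N f c)) (sym (*-distribʳ-+ c (sumFrom1 N f) (f (suc N))))

2*[1+i]∸1≡1+2*i : ∀ i → 2 *ℕ suc i ∸ℕ 1 ≡ suc (2 *ℕ i)
2*[1+i]∸1≡1+2*i i = cong (_∸ℕ 1) (ℕ.*-suc 2 i)

sumOdd : ℕ → (ℕ → ℚ) → ℚ
sumOdd N F = sumFrom1 N (λ k → F (2 *ℕ k ∸ℕ 1))

sumOdd-cong : ∀ N {F H : ℕ → ℚ} → (∀ m → F (suc m) ≡ H (suc m)) → sumOdd N F ≡ sumOdd N H
sumOdd-cong N {F} {H} F≗H = sumFrom1-cong N
  (λ i → subst (λ j → F j ≡ H j) (sym (2*[1+i]∸1≡1+2*i i)) (F≗H (2 *ℕ i)))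

binomialPrefixSum : ℕ → ℕ → ℚ
binomialPrefixSum n M = sumFrom1 M (λ j → fromℕ (n C (j ∸ℕ 1)))

binomialPrefixSum-pascal : ∀ n M →
  binomialPrefixSum (suc n) (suc M) ≡ binomialPrefixSum n (suc M) + binomialPrefixSum n M
binomialPrefixSum-pascal n zero    = refl
binomialPrefixSum-pascal n (suc M) = begin
  binomialPrefixSum (suc n) (suc M) + fromℕ (suc n C suc M)
    ≡⟨ cong₂ _+_ (binomialPrefixSum-pascal n M)
                 (trans (cong fromℕ (sym (nCk+nC[k+1]≡[n+1]C[k+1] n M))) (fromℕ-homo-+ (n C M) (n C suc M))) ⟩
  (binomialPrefixSum n (suc M) + binomialPrefixSum n M) + (fromℕ (n C M) + fromℕ (n C suc M))
    ≡⟨ solve 4 (λ a b c d → (a :+ b) :+ (c :+ d) := (a :+ d) :+ (b :+ c)) refl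
         (binomialPrefixSum n (suc M)) (binomialPrefixSum n M) (fromℕ (n C M)) (fromℕ (n C suc M)) ⟩
  binomialPrefixSum n (suc (suc M)) + binomialPrefixSum n (suc M)
    ∎
  where
  open ≡-Reasoning
  open +-*-Solver

binomialPrefixSum≡2^n : ∀ n M → n < M → binomialPrefixSum n M ≡ powℚ (fromℕ 2) n
binomialPrefixSum≡2^n zero    (suc zero)    _           = refl
binomialPrefixSum≡2^n zero    (suc (suc M)) _           =
  trans (+-identityʳ _) (binomialPrefixSum≡2^n zero (suc M) (s≤s z≤n))
binomialPrefixSum≡2^n (suc n) (suc M)       (s≤s n<M) = begin
  binomialPrefixSum (suc n) (suc M)                   ≡⟨ binomialPrefixSum-pascal n M ⟩
  binomialPrefixSum n (suc M) + binomialPrefixSum n M ≡⟨ cong₂ _+_ (binomialPrefixSum≡2^n n (suc M) (ℕ.m<n⇒m<1+n n<M))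
                                                                     (binomialPrefixSum≡2^n n M n<M) ⟩
  powℚ (fromℕ 2) n + powℚ (fromℕ 2) n                 ≡⟨ solve 1 (λ x → x :+ x := con (fromℕ 2) :* x) refl (powℚ (fromℕ 2) n) ⟩
  powℚ (fromℕ 2) (suc n)                              ∎
  where
  open ≡-Reasoning
  open +-*-Solver

sumOdd-binomial : ∀ n N → sumOdd N (λ j → fromℕ (suc n C j)) ≡ binomialPrefixSum n (2 *ℕ N)
sumOdd-binomial n zero    = refl
sumOdd-binomial n (suc N) = begin
  sumOdd N f + fromℕ (suc n C (2 *ℕ suc N ∸ℕ 1))
    ≡⟨ cong (λ j → sumOdd N f + fromℕ (suc n C j)) (2*[1+i]∸1≡1+2*i N) ⟩
  sumOdd N f + fromℕ (suc n C suc (2 *ℕ N))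
    ≡⟨ cong₂ _+_ (sumOdd-binomial n N)
                 (trans (cong fromℕ (sym (nCk+nC[k+1]≡[n+1]C[k+1] n (2 *ℕ N)))) (fromℕ-homo-+ (n C (2 *ℕ N)) (n C suc (2 *ℕ N)))) ⟩
  binomialPrefixSum n (2 *ℕ N) + (fromℕ (n C (2 *ℕ N)) + fromℕ (n C suc (2 *ℕ N)))
    ≡⟨ solve 3 (λ a b c → a :+ (b :+ c) := (a :+ b) :+ c) refl
         (binomialPrefixSum n (2 *ℕ N)) (fromℕ (n C (2 *ℕ N))) (fromℕ (n C suc (2 *ℕ N))) ⟩
  binomialPrefixSum n (suc (suc (2 *ℕ N)))
    ≡⟨ cong (binomialPrefixSum n) (sym (ℕ.*-suc 2 N)) ⟩
  binomialPrefixSum n (2 *ℕ suc N)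
    ∎
  where
  open ≡-Reasoning
  open +-*-Solver
  f = λ j → fromℕ (suc n C j)

oddBinomialSum : ℕ → ℕ → ℕ → ℚ
oddBinomialSum d n N = sumOdd N (λ j → fromℕ (n C j) * invPow j d)

ζ⋆ : ℕ → ℕ → ℚ
ζ⋆ d n = zetaStar n (replicate d 1) (fromℕ 2)

oddBinomialSum-0 : ∀ n N → suc n ≤ 2 *ℕ N → oddBinomialSum 0 (suc n) N ≡ ζ⋆ 0 (suc n) * ½
oddBinomialSum-0 n N 1+n≤2N = begin
  oddBinomialSum 0 (suc n) N                 ≡⟨ sumFrom1-cong N (λ _ → *-identityʳ _) ⟩
  sumOdd N (λ j → fromℕ (suc n C j))         ≡⟨ sumOdd-binomial n N ⟩
  binomialPrefixSum n (2 *ℕ N)               ≡⟨ binomialPrefixSum≡2^n n (2 *ℕ N) 1+n≤2N ⟩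
  powℚ (fromℕ 2) n                           ≡⟨ solve 1 (λ x → x := (con (fromℕ 2) :* x) :* con ½) refl (powℚ (fromℕ 2) n) ⟩
  ζ⋆ 0 (suc n) * ½                           ∎
  where
  open ≡-Reasoning
  open +-*-Solver

absorption : ∀ e n m →
  fromℕ (n C m) * invPow (suc m) (suc e) ≡ fromℕ (suc n C suc m) * invPow (suc m) e * invPow (suc n) 1
absorption e n m = begin
  fromℕ (n C m) * x
    ≡⟨ solve 2 (λ c x → c :* x := c :* x :* con 1ℚ) refl (fromℕ (n C m)) x ⟩
  fromℕ (n C m) * x * 1ℚ
    ≡⟨ cong (fromℕ (n C m) * x *_) (sym (fromℕ-*-invPow-suc n 0)) ⟩
  fromℕ (n C m) * x * (fromℕ (suc n) * p)
    ≡⟨ solve 4 (λ c x n p → c :* x :* (n :* p) := (n :* c) :* x :* p) refl (fromℕ (n C m)) x (fromℕ (suc n)) p ⟩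
  fromℕ (suc n) * fromℕ (n C m) * x * p
    ≡⟨ cong (λ a → a * x * p) (sym (fromℕ-homo-* (suc n) (n C m))) ⟩
  fromℕ (suc n *ℕ (n C m)) * x * p
    ≡⟨ cong (λ a → fromℕ a * x * p) (sym ([k+1]*[n+1]C[k+1]≡[n+1]*nCk n m)) ⟩
  fromℕ (suc m *ℕ (suc n C suc m)) * x * p
    ≡⟨ cong (λ a → a * x * p) (fromℕ-homo-* (suc m) (suc n C suc m)) ⟩
  fromℕ (suc m) * fromℕ (suc n C suc m) * x * p
    ≡⟨ solve 4 (λ m c x p → m :* c :* x :* p := c :* (m :* x) :* p) refl (fromℕ (suc m)) (fromℕ (suc n C suc m)) x p ⟩
  fromℕ (suc n C suc m) * (fromℕ (suc m) * x) * p
    ≡⟨ cong (λ y → fromℕ (suc n C suc m) * y * p) (fromℕ-*-invPow-suc m e) ⟩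
  fromℕ (suc n C suc m) * invPow (suc m) e * p
    ∎
  where
  open ≡-Reasoning
  open +-*-Solver
  x = invPow (suc m) (suc e)
  p = invPow (suc n) 1

oddBinomialSum-pascal : ∀ e n N →
  oddBinomialSum (suc e) (suc n) N ≡ oddBinomialSum (suc e) n N + oddBinomialSum e (suc n) N * invPow (suc n) 1
oddBinomialSum-pascal e n N = begin
  oddBinomialSum (suc e) (suc n) N
    ≡⟨ sumOdd-cong N {λ j → fromℕ (suc n C j) * invPow j (suc e)} {split} term ⟩
  sumOdd N split
    ≡⟨ sumFrom1-+ N _ _ ⟩
  oddBinomialSum (suc e) n N + sumOdd N (λ j → fromℕ (suc n C j) * invPow j e * p)
    ≡⟨ cong (_+_ (oddBinomialSum (suc e) n N)) (sumFrom1-*ʳ N _ p) ⟩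
  oddBinomialSum (suc e) n N + oddBinomialSum e (suc n) N * p
    ∎
  where
  open ≡-Reasoning
  open +-*-Solver
  p = invPow (suc n) 1
  split : ℕ → ℚ
  split j = fromℕ (n C j) * invPow j (suc e) + fromℕ (suc n C j) * invPow j e * p
  term : ∀ m → fromℕ (suc n C suc m) * invPow (suc m) (suc e)
             ≡ fromℕ (n C suc m) * invPow (suc m) (suc e) + fromℕ (suc n C suc m) * invPow (suc m) e * p
  term m = begin
    fromℕ (suc n C suc m) * x
      ≡⟨ cong (λ a → fromℕ a * x) (sym (nCk+nC[k+1]≡[n+1]C[k+1] n m)) ⟩
    fromℕ (n C m +ℕ n C suc m) * x
      ≡⟨ cong (_* x) (fromℕ-homo-+ (n C m) (n C suc m)) ⟩
    (fromℕ (n C m) + fromℕ (n C suc m)) * x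
      ≡⟨ solve 3 (λ a b x → (a :+ b) :* x := b :* x :+ a :* x) refl (fromℕ (n C m)) (fromℕ (n C suc m)) x ⟩
    fromℕ (n C suc m) * x + fromℕ (n C m) * x
      ≡⟨ cong (_+_ (fromℕ (n C suc m) * x)) (absorption e n m) ⟩
    fromℕ (n C suc m) * x + fromℕ (suc n C suc m) * invPow (suc m) e * p
      ∎
    where x = invPow (suc m) (suc e)

oddBinomialSum≡ζ⋆/2 : ∀ e n N → n ≤ 2 *ℕ N → oddBinomialSum (suc e) n N ≡ ζ⋆ (suc e) n * ½
oddBinomialSum≡ζ⋆/2 e zero    N _      =
  trans (sumOdd-cong N {λ j → fromℕ (0 C j) * invPow j (suc e)} {λ _ → 0ℚ} (λ m → *-zeroˡ (invPow (suc m) (suc e))))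
        (sumFrom1-0 N)
oddBinomialSum≡ζ⋆/2 e (suc n) N 1+n≤2N = begin
  oddBinomialSum (suc e) (suc n) N
    ≡⟨ oddBinomialSum-pascal e n N ⟩
  oddBinomialSum (suc e) n N + oddBinomialSum e (suc n) N * p
    ≡⟨ cong₂ (λ a b → a + b * p) (oddBinomialSum≡ζ⋆/2 e n N (ℕ.<⇒≤ 1+n≤2N)) (lower e) ⟩
  ζ⋆ (suc e) n * ½ + ζ⋆ e (suc n) * ½ * p
    ≡⟨ solve 4 (λ a b h p → a :* h :+ b :* h :* p := (a :+ p :* b) :* h) refl (ζ⋆ (suc e) n) (ζ⋆ e (suc n)) ½ p ⟩
  ζ⋆ (suc e) (suc n) * ½
    ∎
  where
  open ≡-Reasoning
  open +-*-Solver
  p = invPow (suc n) 1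
  lower : ∀ e → oddBinomialSum e (suc n) N ≡ ζ⋆ e (suc n) * ½
  lower zero    = oddBinomialSum-0 n N 1+n≤2N
  lower (suc e) = oddBinomialSum≡ζ⋆/2 e (suc n) N 1+n≤2N

corollary1 : (d n : ℕ) → d ≥ 1 →
    sumFrom1 ((n +ℕ 1) /ℕ 2)
        (λ k → (+ (n C (2 *ℕ k ∸ℕ 1)) / 1) * invPow (2 *ℕ k ∸ℕ 1) d)
      ≡ zetaStar n (replicate d 1) (+ 2 / 1) * (+ 1 / 2)
corollary1 zero    n ()
corollary1 (suc e) n _ = oddBinomialSum≡ζ⋆/2 e n ((n +ℕ 1) /ℕ 2) (n≤2*[[n+1]/2] n)
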